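{- Let $n\ge1$. An interval $(S,T)$ of the Tamari lattice $\mathbf{Tam}_n$ is synchronous (i.e. the canopy of $S$ equals the canopy of $T$) if and only if $b+c=n-1$, where $b$ is the number of elements covering $T$ in $\mathbf{Tam}_n$ and $c$ is the number of elements covered by $S$ in $\mathbf{Tam}_n$ (equivalently, the monomial of $(S,T)$ in $\mathbb{D}_{\mathbf{Tam}_n}$ has total degree $n-1$ in the variables $y,\overline{y}$).
   Context: For $n\ge1$, $\mathbf{Tam}_n$ is the poset on planar binary trees with $n$ internal vertices ($n+1$ leaves) whose covering relations are the rotations replacing a subtree of the form $(A,(B,C))$ (an internal vertex with left subtree $A$ and right subtree an internal vertex with subtrees $B,C$) by $((A,B),C)$; the order is the reflexive-transitive closure. An interval is a pair $(S,T)$ with $S\le T$. The canopy of a binary tree with $n\ge 1$ internal vertices is the word of length $n+1$ in letters $L,R$ obtained by reading the leaves from left to right and writing $L$ if the leaf is a left child of its parent and $R$ if it is a right child. In $\mathbb{D}_{\mathbf{Tam}_n}(x,y,\overline{y},\overline{x})=\sum_{(S,T)}x^a y^b\overline{y}^c\overline{x}^d$, the exponent $b$ is the number of elements covering $T$, and $c$ the number of elements covered by $S$ ($a$, $d$ count the covers $S\triangleleft S'\le T$ and $S\le T'\triangleleft T$ respectively). -}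

module Defs where

open import Data.Nat using (ℕ; zero; suc; _+_; _≟_)
open import Data.List using (List; []; _∷_; _++_; concatMap; map; filter; length)
open import Data.Product using (_×_; _,_)
open import Data.Sum using (_⊎_; inj₁; inj₂)
open import Relation.Nullary using (Dec; yes; no; ¬_)
open import Relation.Nullary.Decidable using (map′; _×-dec_; _⊎-dec_)
open import Data.Empty using (⊥)
open import Relation.Binary.PropositionalEquality using (_≡_; refl; cong; cong₂)
open import Relation.Binary.Construct.Closure.ReflexiveTransitive using (Star)

data Tree : Set where
  leaf : Tree
  node : Tree → Tree → Tree

size : Tree → ℕ
size leaf = 0
size (node l r) = suc (size l + size r)

-- One rotation (A,(B,C)) ↦ ((A,B),C) applied at some vertex: the covering relation of Tam_n.
data _⋖_ : Tree → Tree → Set where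
  rot-here  : ∀ {A B C} → node A (node B C) ⋖ node (node A B) C
  rot-left  : ∀ {A A' B} → A ⋖ A' → node A B ⋖ node A' B
  rot-right : ∀ {A B B'} → B ⋖ B' → node A B ⋖ node A B'

_≤T_ : Tree → Tree → Set
_≤T_ = Star _⋖_

node-injˡ : ∀ {a b c d} → node a b ≡ node c d → a ≡ c
node-injˡ refl = refl

node-injʳ : ∀ {a b c d} → node a b ≡ node c d → b ≡ d
node-injʳ refl = refl

_≟T_ : (s t : Tree) → Dec (s ≡ t)
leaf ≟T leaf = yes refl
leaf ≟T node _ _ = no λ ()
node _ _ ≟T leaf = no λ ()
node a b ≟T node c d with a ≟T c | b ≟T d
... | yes refl | yes refl = yes refl
... | no a≢c | _ = no λ e → a≢c (node-injˡ e)
... | yes _ | no b≢d = no λ e → b≢d (node-injʳ e)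

Here : Tree → Tree → Tree → Tree → Set
Here a leaf c d = ⊥
Here a (node B C) c d = (c ≡ node a B) × (d ≡ C)

here? : ∀ a b c d → Dec (Here a b c d)
here? a leaf c d = no λ ()
here? a (node B C) c d = (c ≟T node a B) ×-dec (d ≟T C)

toRel : ∀ {a b c d} → Here a b c d ⊎ ((a ⋖ c) × (b ≡ d)) ⊎ ((a ≡ c) × (b ⋖ d)) → node a b ⋖ node c d
toRel {b = leaf} (inj₁ ())
toRel {b = node B C} (inj₁ (refl , refl)) = rot-here
toRel (inj₂ (inj₁ (p , refl))) = rot-left p
toRel (inj₂ (inj₂ (refl , q))) = rot-right q

fromRel : ∀ {a b c d} → node a b ⋖ node c d → Here a b c d ⊎ ((a ⋖ c) × (b ≡ d)) ⊎ ((a ≡ c) × (b ⋖ d))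
fromRel rot-here = inj₁ (refl , refl)
fromRel (rot-left p) = inj₂ (inj₁ (p , refl))
fromRel (rot-right q) = inj₂ (inj₂ (refl , q))

_⋖?_ : (s t : Tree) → Dec (s ⋖ t)
leaf ⋖? t = no λ ()
node a b ⋖? leaf = no λ ()
node a b ⋖? node c d =
  map′ toRel fromRel (here? a b c d ⊎-dec (((a ⋖? c) ×-dec (b ≟T d)) ⊎-dec ((a ≟T c) ×-dec (b ⋖? d))))

depthLE : ℕ → List Tree
depthLE zero = leaf ∷ []
depthLE (suc k) = leaf ∷ concatMap (λ l → map (node l) (depthLE k)) (depthLE k)

-- All planar binary trees with n internal vertices (the elements of Tam_n);
-- such a tree has depth ≤ n.
trees : ℕ → List Tree
trees n = filter (λ t → size t ≟ n) (depthLE n)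

numUpper : ℕ → Tree → ℕ
numUpper n T = length (filter (λ T' → T ⋖? T') (trees n))

numLower : ℕ → Tree → ℕ
numLower n S = length (filter (λ S' → S' ⋖? S) (trees n))

data Letter : Set where
  L R : Letter

canopyAux : Letter → Tree → List Letter
canopyAux x leaf = x ∷ []
canopyAux x (node l r) = canopyAux L l ++ canopyAux R r

canopy : Tree → List Letter
canopy leaf = []
canopy (node l r) = canopyAux L l ++ canopyAux R r

-- An upper cover of T rotates at an internal vertex whose right child is internal, and every
-- internal vertex whose right child is a leaf produces an R in the canopy; so b + #R(T) = n.
-- Dually c + #L(S) = n, and as the canopy of S has n + 1 letters, c + 1 = #R(S). Hence
-- b + c = n - 1 exactly when #R(S) = #R(T). A rotation only turns some L of the canopy into
-- an R, so along S ≤ T the canopy grows letterwise and #R(S) = #R(T) forces equal canopies.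
module Submission where

open import Defs
open import Data.Nat using (ℕ; zero; suc; _≤_; _+_; _∸_; _≟_; z≤n; s≤s)
open import Data.Nat.Properties
  using (≤-trans; ≤-reflexive; +-assoc; m+n≤o⇒m≤o; m+n≤o⇒n≤o; +-suc; +-comm; +-cancelˡ-≡; suc-injective;
         1+n≰n; m≤m+n; m≤n+m; m≤n⇒m≤1+n)
open import Data.Nat.Tactic.RingSolver using (solve-∀)
open import Data.List using (List; []; _∷_; _++_; map; concatMap; filter; length)
open import Data.List.Properties using (length-++; length-map; ++-assoc)
open import Data.List.Relation.Unary.Any using (here; there)
open import Data.List.Relation.Unary.All as All using (All; [])
import Data.List.Relation.Unary.All.Properties as All
open import Data.List.Relation.Unary.AllPairs as AllPairs using ([]; _∷_)
import Data.List.Relation.Unary.AllPairs.Properties as AllPairs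
open import Data.List.Relation.Unary.Unique.Propositional using (Unique)
import Data.List.Relation.Unary.Unique.Propositional.Properties as Unique
open import Data.List.Relation.Binary.Disjoint.Propositional using (Disjoint)
open import Data.List.Relation.Binary.Pointwise as Pointwise using (Pointwise; []; _∷_)
open import Data.List.Relation.Binary.BagAndSetEquality using (∼bag⇒↭)
open import Data.List.Relation.Binary.Permutation.Propositional.Properties using (↭-length)
open import Data.List.Membership.Propositional using (_∈_; _∉_)
open import Data.List.Membership.Propositional.Properties
  using (∈-map⁺; ∈-map⁻; ∈-++⁺ˡ; ∈-++⁺ʳ; ∈-++⁻; ∈-concat⁺′; ∈-filter⁺; ∈-filter⁻)
open import Data.List.Membership.Propositional.Properties.WithK using (unique∧set⇒bag)
open import Data.Product using (_×_; _,_; proj₂; ∃-syntax)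
open import Data.Sum using (_⊎_; inj₁; inj₂)
open import Data.Empty using (⊥-elim)
open import Function.Bundles using (_⇔_; mk⇔; Equivalence)
open import Relation.Unary using (Pred; Decidable)
open import Relation.Binary.PropositionalEquality
  using (_≡_; _≢_; refl; sym; trans; cong; cong₂; subst; module ≡-Reasoning)
open import Relation.Binary.Construct.Closure.ReflexiveTransitive using (ε; _◅_)

length-unique-≈set : ∀ {a} {A : Set a} {xs ys : List A} → Unique xs → Unique ys →
                     (∀ {x} → x ∈ xs ⇔ x ∈ ys) → length xs ≡ length ys
length-unique-≈set xs! ys! xs≈ys = ↭-length (∼bag⇒↭ (unique∧set⇒bag xs! ys! xs≈ys))

length-++-map-++-map : ∀ {a b c} {A : Set a} {B : Set b} {C : Set c} (zs : List C)
                       (f : A → C) (xs : List A) (g : B → C) (ys : List B) →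
                       length (zs ++ map f xs ++ map g ys) ≡ length zs + (length xs + length ys)
length-++-map-++-map zs f xs g ys = begin
  length (zs ++ map f xs ++ map g ys)                    ≡⟨ length-++ zs ⟩
  length zs + length (map f xs ++ map g ys)              ≡⟨ cong (length zs +_) (length-++ (map f xs)) ⟩
  length zs + (length (map f xs) + length (map g ys))
    ≡⟨ cong (length zs +_) (cong₂ _+_ (length-map f xs) (length-map g ys)) ⟩
  length zs + (length xs + length ys)                    ∎
  where open ≡-Reasoning

∈-++-map-++-map⁻ : ∀ {a b c} {A : Set a} {B : Set b} {C : Set c} (zs : List C)
                   {f : A → C} (xs : List A) {g : B → C} {ys : List B} {v} →
                   v ∈ zs ++ map f xs ++ map g ys →
                   v ∈ zs ⊎ (∃[ x ] x ∈ xs × v ≡ f x) ⊎ (∃[ y ] y ∈ ys × v ≡ g y)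
∈-++-map-++-map⁻ zs xs v∈ with ∈-++⁻ zs v∈
... | inj₁ v∈zs = inj₁ v∈zs
... | inj₂ v∈′ with ∈-++⁻ (map _ xs) v∈′
...   | inj₁ v∈ˡ = inj₂ (inj₁ (∈-map⁻ _ v∈ˡ))
...   | inj₂ v∈ʳ = inj₂ (inj₂ (∈-map⁻ _ v∈ʳ))

∈-depthLE : ∀ k t → size t ≤ k → t ∈ depthLE k
∈-depthLE zero    leaf       _        = here refl
∈-depthLE (suc k) leaf       _        = here refl
∈-depthLE (suc k) (node l r) (s≤s le) =
  there (∈-concat⁺′ (∈-map⁺ (node l) (∈-depthLE k r (m+n≤o⇒n≤o (size l) le)))
                    (∈-map⁺ (λ l′ → map (node l′) (depthLE k)) (∈-depthLE k l (m+n≤o⇒m≤o (size l) le))))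

depthLE-unique : ∀ k → Unique (depthLE k)
depthLE-unique zero    = [] ∷ []
depthLE-unique (suc k) =
  leaf∉nodes ∷ Unique.concat⁺ (All.map⁺ (All.universal rows! (depthLE k)))
                              (AllPairs.map⁺ (AllPairs.map rows-disjoint (depthLE-unique k)))
  where
  leaf∉nodes : All (leaf ≢_) (concatMap (λ l → map (node l) (depthLE k)) (depthLE k))
  leaf∉nodes = All.concat⁺ (All.map⁺ (All.universal leaf∉row (depthLE k)))
    where
    leaf∉row : ∀ l → All (leaf ≢_) (map (node l) (depthLE k))
    leaf∉row l = All.map⁺ (All.universal (λ _ ()) (depthLE k))

  rows! : ∀ l → Unique (map (node l) (depthLE k))
  rows! l = Unique.map⁺ node-injʳ (depthLE-unique k)

  rows-disjoint : ∀ {l l′} → l ≢ l′ → Disjoint (map (node l) (depthLE k)) (map (node l′) (depthLE k))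
  rows-disjoint l≢l′ (v∈ , v∈′) with ∈-map⁻ (node _) v∈ | ∈-map⁻ (node _) v∈′
  ... | _ , _ , refl | _ , _ , eq = l≢l′ (node-injˡ eq)

trees-unique : ∀ n → Unique (trees n)
trees-unique n = Unique.filter⁺ (λ t → size t ≟ n) (depthLE-unique n)

∈-trees : ∀ {n t} → t ∈ trees n ⇔ size t ≡ n
∈-trees {n} {t} = mk⇔ (λ t∈ → proj₂ (∈-filter⁻ (λ u → size u ≟ n) {xs = depthLE n} t∈))
                      (λ eq → ∈-filter⁺ (λ u → size u ≟ n) (∈-depthLE n t (≤-reflexive eq)) eq)

length-filter-trees : ∀ n {p} {P : Pred Tree p} (P? : Decidable P) {xs : List Tree} → Unique xs →
                      (∀ {t} → t ∈ xs ⇔ (size t ≡ n × P t)) → length (filter P? (trees n)) ≡ length xs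
length-filter-trees n P? {xs} xs! xs≈P =
  length-unique-≈set (Unique.filter⁺ P? (trees-unique n)) xs! (mk⇔ to from)
  where
  to : ∀ {t} → t ∈ filter P? (trees n) → t ∈ xs
  to t∈ = let (t∈trees , Pt) = ∈-filter⁻ P? {xs = trees n} t∈
          in Equivalence.from xs≈P (Equivalence.to ∈-trees t∈trees , Pt)

  from : ∀ {t} → t ∈ xs → t ∈ filter P? (trees n)
  from t∈ = let (∣t∣ , Pt) = Equivalence.to xs≈P t∈
            in ∈-filter⁺ P? (Equivalence.from ∈-trees ∣t∣) Pt

node≢left : ∀ {A B} → node A B ≢ A
node≢left {A} {B} eq = 1+n≰n (≤-trans (s≤s (m≤m+n (size A) (size B))) (≤-reflexive (cong size eq)))

node≢right : ∀ {A B} → node A B ≢ B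
node≢right {A} {B} eq = 1+n≰n (≤-trans (s≤s (m≤n+m (size B) (size A))) (≤-reflexive (cong size eq)))

⋖-irrefl : ∀ {s t} → s ⋖ t → s ≢ t
⋖-irrefl rot-here      eq = node≢left (sym (node-injˡ eq))
⋖-irrefl (rot-left p)  eq = ⋖-irrefl p (node-injˡ eq)
⋖-irrefl (rot-right p) eq = ⋖-irrefl p (node-injʳ eq)

⋖-size : ∀ {s t} → s ⋖ t → size s ≡ size t
⋖-size (rot-here {A} {B} {C}) =
  cong suc (trans (+-suc (size A) (size B + size C)) (cong suc (sym (+-assoc (size A) (size B) (size C)))))
⋖-size (rot-left p)  = cong (λ m → suc (m + _)) (⋖-size p)
⋖-size (rot-right p) = cong (λ m → suc (_ + m)) (⋖-size p)

map-node-disjoint : ∀ {A B} {xs ys : List Tree} → A ∉ xs →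
                    Disjoint (map (λ A′ → node A′ B) xs) (map (node A) ys)
map-node-disjoint A∉xs (v∈ˡ , v∈ʳ) with ∈-map⁻ _ v∈ˡ | ∈-map⁻ _ v∈ʳ
... | _ , A′∈xs , refl | _ , _ , eq = A∉xs (subst (_∈ _) (node-injˡ eq) A′∈xs)

rootUpperCover : Tree → Tree → List Tree
rootUpperCover A leaf       = []
rootUpperCover A (node B C) = node (node A B) C ∷ []

upperCovers : Tree → List Tree
upperCovers leaf       = []
upperCovers (node A B) =
  rootUpperCover A B ++ map (λ A′ → node A′ B) (upperCovers A) ++ map (node A) (upperCovers B)

upperCovers⁻ : ∀ {t v} → v ∈ upperCovers t → t ⋖ v
upperCovers⁻ {node A B} v∈ with ∈-++-map-++-map⁻ (rootUpperCover A B) (upperCovers A) v∈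
upperCovers⁻ {node A (node B C)} _ | inj₁ (here refl) = rot-here
... | inj₂ (inj₁ (_ , A′∈ , refl)) = rot-left (upperCovers⁻ A′∈)
... | inj₂ (inj₂ (_ , B′∈ , refl)) = rot-right (upperCovers⁻ B′∈)

upperCovers⁺ : ∀ {t v} → t ⋖ v → v ∈ upperCovers t
upperCovers⁺ rot-here = here refl
upperCovers⁺ {node A B} (rot-left p) =
  ∈-++⁺ʳ (rootUpperCover A B) (∈-++⁺ˡ (∈-map⁺ (λ A′ → node A′ B) (upperCovers⁺ p)))
upperCovers⁺ {node A B} (rot-right p) =
  ∈-++⁺ʳ (rootUpperCover A B) (∈-++⁺ʳ _ (∈-map⁺ (node A) (upperCovers⁺ p)))

upperCovers-unique : ∀ t → Unique (upperCovers t)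
upperCovers-unique leaf       = []
upperCovers-unique (node A B) =
  Unique.++⁺ (root! B)
             (Unique.++⁺ (Unique.map⁺ node-injˡ (upperCovers-unique A))
                         (Unique.map⁺ node-injʳ (upperCovers-unique B))
                         (map-node-disjoint (λ A∈ → ⋖-irrefl (upperCovers⁻ A∈) refl)))
             (root-disjoint B)
  where
  root! : ∀ B → Unique (rootUpperCover A B)
  root! leaf       = []
  root! (node _ _) = [] ∷ []

  root-disjoint : ∀ B → Disjoint (rootUpperCover A B)
                                 (map (λ A′ → node A′ B) (upperCovers A) ++ map (node A) (upperCovers B))
  root-disjoint (node B C) (here refl , v∈) with ∈-++-map-++-map⁻ [] (upperCovers A) v∈
  ... | inj₂ (inj₁ (_ , _ , eq)) = node≢right (sym (node-injʳ eq))
  ... | inj₂ (inj₂ (_ , _ , eq)) = node≢left (node-injˡ eq)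

rootLowerCover : Tree → Tree → List Tree
rootLowerCover leaf       C = []
rootLowerCover (node A B) C = node A (node B C) ∷ []

lowerCovers : Tree → List Tree
lowerCovers leaf       = []
lowerCovers (node A B) =
  rootLowerCover A B ++ map (λ A′ → node A′ B) (lowerCovers A) ++ map (node A) (lowerCovers B)

lowerCovers⁻ : ∀ {t v} → v ∈ lowerCovers t → v ⋖ t
lowerCovers⁻ {node A B} v∈ with ∈-++-map-++-map⁻ (rootLowerCover A B) (lowerCovers A) v∈
lowerCovers⁻ {node (node A B) C} _ | inj₁ (here refl) = rot-here
... | inj₂ (inj₁ (_ , A′∈ , refl)) = rot-left (lowerCovers⁻ A′∈)
... | inj₂ (inj₂ (_ , B′∈ , refl)) = rot-right (lowerCovers⁻ B′∈)

lowerCovers⁺ : ∀ {t v} → v ⋖ t → v ∈ lowerCovers t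
lowerCovers⁺ rot-here = here refl
lowerCovers⁺ {node A B} (rot-left p) =
  ∈-++⁺ʳ (rootLowerCover A B) (∈-++⁺ˡ (∈-map⁺ (λ A′ → node A′ B) (lowerCovers⁺ p)))
lowerCovers⁺ {node A B} (rot-right p) =
  ∈-++⁺ʳ (rootLowerCover A B) (∈-++⁺ʳ _ (∈-map⁺ (node A) (lowerCovers⁺ p)))

lowerCovers-unique : ∀ t → Unique (lowerCovers t)
lowerCovers-unique leaf       = []
lowerCovers-unique (node A B) =
  Unique.++⁺ (root! A)
             (Unique.++⁺ (Unique.map⁺ node-injˡ (lowerCovers-unique A))
                         (Unique.map⁺ node-injʳ (lowerCovers-unique B))
                         (map-node-disjoint (λ A∈ → ⋖-irrefl (lowerCovers⁻ A∈) refl)))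
             (root-disjoint A)
  where
  root! : ∀ A → Unique (rootLowerCover A B)
  root! leaf       = []
  root! (node _ _) = [] ∷ []

  root-disjoint : ∀ A → Disjoint (rootLowerCover A B)
                                 (map (λ A′ → node A′ B) (lowerCovers A) ++ map (node A) (lowerCovers B))
  root-disjoint (node A₁ A₂) (here refl , v∈) with ∈-++-map-++-map⁻ [] (lowerCovers (node A₁ A₂)) v∈
  ... | inj₂ (inj₁ (_ , _ , eq)) = node≢right (node-injʳ eq)
  ... | inj₂ (inj₂ (_ , _ , eq)) = node≢left (sym (node-injˡ eq))

numUpper≡length-upperCovers : ∀ {n T} → size T ≡ n → numUpper n T ≡ length (upperCovers T)
numUpper≡length-upperCovers {n} {T} ∣T∣ =
  length-filter-trees n (T ⋖?_) (upperCovers-unique T)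
    (mk⇔ (λ v∈ → trans (sym (⋖-size (upperCovers⁻ v∈))) ∣T∣ , upperCovers⁻ v∈)
         (λ (_ , T⋖v) → upperCovers⁺ T⋖v))

numLower≡length-lowerCovers : ∀ {n S} → size S ≡ n → numLower n S ≡ length (lowerCovers S)
numLower≡length-lowerCovers {n} {S} ∣S∣ =
  length-filter-trees n (_⋖? S) (lowerCovers-unique S)
    (mk⇔ (λ v∈ → trans (⋖-size (lowerCovers⁻ v∈)) ∣S∣ , lowerCovers⁻ v∈)
         (λ (_ , v⋖S) → lowerCovers⁺ v⋖S))

#L #R : List Letter → ℕ
#L []      = 0
#L (L ∷ w) = suc (#L w)
#L (R ∷ w) = #L w
#R []      = 0
#R (L ∷ w) = #R w
#R (R ∷ w) = suc (#R w)

#L-++ : ∀ u w → #L (u ++ w) ≡ #L u + #L w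
#L-++ []      w = refl
#L-++ (L ∷ u) w = cong suc (#L-++ u w)
#L-++ (R ∷ u) w = #L-++ u w

#R-++ : ∀ u w → #R (u ++ w) ≡ #R u + #R w
#R-++ []      w = refl
#R-++ (L ∷ u) w = #R-++ u w
#R-++ (R ∷ u) w = cong suc (#R-++ u w)

#L+#R≡length : ∀ w → #L w + #R w ≡ length w
#L+#R≡length []      = refl
#L+#R≡length (L ∷ w) = cong suc (#L+#R≡length w)
#L+#R≡length (R ∷ w) = trans (+-suc (#L w) (#R w)) (cong suc (#L+#R≡length w))

length-canopyAux : ∀ x t → length (canopyAux x t) ≡ suc (size t)
length-canopyAux x leaf       = refl
length-canopyAux x (node A B) = begin
  length (canopyAux L A ++ canopyAux R B)           ≡⟨ length-++ (canopyAux L A) ⟩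
  length (canopyAux L A) + length (canopyAux R B)   ≡⟨ cong₂ _+_ (length-canopyAux L A) (length-canopyAux R B) ⟩
  suc (size A) + suc (size B)                       ≡⟨ cong suc (+-suc (size A) (size B)) ⟩
  suc (suc (size A + size B))                       ∎
  where open ≡-Reasoning

length-upperCovers+#R : ∀ t → length (upperCovers t) + #R (canopy t) ≡ size t
length-upperCovers+#R leaf       = refl
length-upperCovers+#R (node A B) = begin
  length (upperCovers (node A B)) + #R (canopyAux L A ++ canopyAux R B)
    ≡⟨ cong₂ _+_ (length-++-map-++-map root _ (upperCovers A) _ (upperCovers B))
                 (#R-++ (canopyAux L A) (canopyAux R B)) ⟩
  (length root + (uA + uB)) + (#R (canopyAux L A) + #R (canopyAux R B))
    ≡⟨ regroup (length root) uA uB (#R (canopyAux L A)) (#R (canopyAux R B)) ⟩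
  (uA + #R (canopyAux L A)) + (uB + (length root + #R (canopyAux R B)))
    ≡⟨ cong₂ (λ x y → (uA + x) + (uB + y)) (#R-canopyAux-L A) (root+#R B) ⟩
  (uA + #R (canopy A)) + (uB + suc (#R (canopy B)))
    ≡⟨ cong₂ _+_ (length-upperCovers+#R A) (trans (+-suc uB _) (cong suc (length-upperCovers+#R B))) ⟩
  size A + suc (size B)
    ≡⟨ +-suc (size A) (size B) ⟩
  suc (size A + size B) ∎
  where
  open ≡-Reasoning
  root = rootUpperCover A B
  uA = length (upperCovers A)
  uB = length (upperCovers B)

  regroup : ∀ h a b x y → (h + (a + b)) + (x + y) ≡ (a + x) + (b + (h + y))
  regroup = solve-∀

  #R-canopyAux-L : ∀ t → #R (canopyAux L t) ≡ #R (canopy t)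
  #R-canopyAux-L leaf       = refl
  #R-canopyAux-L (node _ _) = refl

  root+#R : ∀ B → length (rootUpperCover A B) + #R (canopyAux R B) ≡ suc (#R (canopy B))
  root+#R leaf       = refl
  root+#R (node _ _) = refl

length-lowerCovers+#L : ∀ t → length (lowerCovers t) + #L (canopy t) ≡ size t
length-lowerCovers+#L leaf       = refl
length-lowerCovers+#L (node A B) = begin
  length (lowerCovers (node A B)) + #L (canopyAux L A ++ canopyAux R B)
    ≡⟨ cong₂ _+_ (length-++-map-++-map root _ (lowerCovers A) _ (lowerCovers B))
                 (#L-++ (canopyAux L A) (canopyAux R B)) ⟩
  (length root + (dA + dB)) + (#L (canopyAux L A) + #L (canopyAux R B))
    ≡⟨ regroup (length root) dA dB (#L (canopyAux L A)) (#L (canopyAux R B)) ⟩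
  (dA + (length root + #L (canopyAux L A))) + (dB + #L (canopyAux R B))
    ≡⟨ cong₂ (λ x y → (dA + x) + (dB + y)) (root+#L A) (#L-canopyAux-R B) ⟩
  (dA + suc (#L (canopy A))) + (dB + #L (canopy B))
    ≡⟨ cong₂ _+_ (trans (+-suc dA _) (cong suc (length-lowerCovers+#L A))) (length-lowerCovers+#L B) ⟩
  suc (size A + size B) ∎
  where
  open ≡-Reasoning
  root = rootLowerCover A B
  dA = length (lowerCovers A)
  dB = length (lowerCovers B)

  regroup : ∀ h a b x y → (h + (a + b)) + (x + y) ≡ (a + (h + x)) + (b + y)
  regroup = solve-∀

  #L-canopyAux-R : ∀ t → #L (canopyAux R t) ≡ #L (canopy t)
  #L-canopyAux-R leaf       = refl
  #L-canopyAux-R (node _ _) = refl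

  root+#L : ∀ A → length (rootLowerCover A B) + #L (canopyAux L A) ≡ suc (#L (canopy A))
  root+#L leaf       = refl
  root+#L (node _ _) = refl

suc-length-lowerCovers : ∀ A B → suc (length (lowerCovers (node A B))) ≡ #R (canopy (node A B))
suc-length-lowerCovers A B = +-cancelˡ-≡ (#L w) _ _ (begin
  #L w + suc d      ≡⟨ +-suc (#L w) d ⟩
  suc (#L w + d)    ≡⟨ cong suc (+-comm (#L w) d) ⟩
  suc (d + #L w)    ≡⟨ cong suc (length-lowerCovers+#L (node A B)) ⟩
  suc (size t)      ≡⟨ sym (length-canopyAux L t) ⟩
  length w          ≡⟨ sym (#L+#R≡length w) ⟩
  #L w + #R w       ∎)
  where
  open ≡-Reasoning
  t = node A B
  w = canopy t
  d = length (lowerCovers t)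

data _≤ᴸ_ : Letter → Letter → Set where
  L≤x : ∀ {x} → L ≤ᴸ x
  R≤R : R ≤ᴸ R

≤ᴸ-refl : ∀ {x} → x ≤ᴸ x
≤ᴸ-refl {L} = L≤x
≤ᴸ-refl {R} = R≤R

≤ᴸ-trans : ∀ {x y z} → x ≤ᴸ y → y ≤ᴸ z → x ≤ᴸ z
≤ᴸ-trans L≤x _   = L≤x
≤ᴸ-trans R≤R R≤R = R≤R

_≤ᶜ_ : List Letter → List Letter → Set
_≤ᶜ_ = Pointwise _≤ᴸ_

≤ᶜ-refl : ∀ {w} → w ≤ᶜ w
≤ᶜ-refl = Pointwise.refl ≤ᴸ-refl

canopyAux-L≤R : ∀ t → canopyAux L t ≤ᶜ canopyAux R t
canopyAux-L≤R leaf       = L≤x ∷ []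
canopyAux-L≤R (node _ _) = ≤ᶜ-refl

canopyAux-mono : ∀ {s t} → s ⋖ t → ∀ x → canopyAux x s ≤ᶜ canopyAux x t
canopyAux-mono (rot-here {A} {B} {C}) _ =
  subst (_≤ᶜ_ (canopyAux L A ++ canopyAux L B ++ canopyAux R C)) (sym (++-assoc (canopyAux L A) _ _))
        (Pointwise.++⁺ (≤ᶜ-refl {canopyAux L A})
                       (Pointwise.++⁺ (canopyAux-L≤R B) (≤ᶜ-refl {canopyAux R C})))
canopyAux-mono (rot-left p)  _ = Pointwise.++⁺ (canopyAux-mono p L) ≤ᶜ-refl
canopyAux-mono (rot-right p) _ = Pointwise.++⁺ ≤ᶜ-refl (canopyAux-mono p R)

canopy-mono : ∀ {s t} → s ≤T t → canopy s ≤ᶜ canopy t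
canopy-mono ε                                 = ≤ᶜ-refl
-- Covers only relate nodes, and on nodes canopy and canopyAux agree.
canopy-mono (_◅_ {node _ _} {node _ _} p s≤t) =
  Pointwise.transitive ≤ᴸ-trans (canopyAux-mono p L) (canopy-mono s≤t)

#R-mono : ∀ {u w} → u ≤ᶜ w → #R u ≤ #R w
#R-mono []                = z≤n
#R-mono (L≤x {L} ∷ u≤w)  = #R-mono u≤w
#R-mono (L≤x {R} ∷ u≤w)  = m≤n⇒m≤1+n (#R-mono u≤w)
#R-mono (R≤R ∷ u≤w)      = s≤s (#R-mono u≤w)

≤ᶜ∧#R≡⇒≡ : ∀ {u w} → u ≤ᶜ w → #R u ≡ #R w → u ≡ w
≤ᶜ∧#R≡⇒≡ []                eq = refl
≤ᶜ∧#R≡⇒≡ (L≤x {L} ∷ u≤w)  eq = cong (L ∷_) (≤ᶜ∧#R≡⇒≡ u≤w eq)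
≤ᶜ∧#R≡⇒≡ (L≤x {R} ∷ u≤w)  eq = ⊥-elim (1+n≰n (≤-trans (≤-reflexive (sym eq)) (#R-mono u≤w)))
≤ᶜ∧#R≡⇒≡ (R≤R ∷ u≤w)      eq = cong (R ∷_) (≤ᶜ∧#R≡⇒≡ u≤w (suc-injective eq))

theorem2 : (n : ℕ) → 1 ≤ n → (S T : Tree) → size S ≡ n → size T ≡ n → S ≤T T →
    (canopy S ≡ canopy T) ⇔ (numUpper n T + numLower n S ≡ n ∸ 1)
theorem2 zero    ()
theorem2 (suc m) _ leaf         T () _   _
theorem2 (suc m) _ S@(node A B) T ∣S∣ ∣T∣ S≤T = mk⇔
  (λ canopy≡ → suc-injective (trans (sym b+#R[S]) (trans (cong (λ w → b + #R w) canopy≡) b+#R[T])))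
  (λ b+c≡m → ≤ᶜ∧#R≡⇒≡ (canopy-mono S≤T)
                       (+-cancelˡ-≡ b _ _ (trans b+#R[S] (trans (cong suc b+c≡m) (sym b+#R[T])))))
  where
  b = numUpper (suc m) T
  c = numLower (suc m) S

  b+#R[T] : b + #R (canopy T) ≡ suc m
  b+#R[T] = trans (cong (_+ #R (canopy T)) (numUpper≡length-upperCovers ∣T∣))
                  (trans (length-upperCovers+#R T) ∣T∣)

  b+#R[S] : b + #R (canopy S) ≡ suc (b + c)
  b+#R[S] = trans (cong (b +_) (trans (sym (suc-length-lowerCovers A B))
                                      (cong suc (sym (numLower≡length-lowerCovers ∣S∣)))))
                  (+-suc b c)
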